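{- Let $n\ge3$, $d\ge0$ and $G\in\mathcal{K}_{n,d}$. Then the deficiency of $G$ is at most $\max\{0,\omega(G)-n+d\}$, where $\omega(G)$ is the clique number of $G$.
   Context: Stretched cliques: stretching a vertex $v$ with sets $A_1,\dots,A_m\subseteq\Gamma(v)$ (possibly empty, union $\Gamma(v)$) replaces $v$ by new vertices $v_0,\dots,v_m$, joining each $v_j$ ($j\in[m]$) to $v_0$ and to all of $A_j$; $m=2$ gives a 2-stretching. $\mathcal{K}_{n,d}$ is the set of graphs obtained from $K_n$ (vertex set $[n]$) by 2-stretching $d$ of its original vertices, each at most once. For $G\in\mathcal{K}_{n,d}$, $D(G)$ is the set of stretched original vertices; for $i\in D(G)$, $i_0$ is a hub and $i_1,i_2$ are wings; vertices in $[n]\setminus D(G)$ are unstretched. The vertices associated with $i$ are $i_0,i_1,i_2$ if $i\in D(G)$ and $i$ otherwise. For a wing $i_\ell$, $\tilde\Gamma_G(i_\ell)$ is the set of $j\in[n]\setminus\{i\}$ such that $i_\ell$ is adjacent to a vertex associated with $j$; $\tilde{\mathcal{K}}_{n,d}$ is the set of $G\in\mathcal{K}_{n,d}$ with $\tilde\Gamma_G(i_\ell)\subsetneq[n]\setminus\{i\}$ for all $i\in D(G)$, $\ell\in\{1,2\}$. A stretched-clique decomposition of $G\in\mathcal{K}_{n,d}$ is a partition $\{C_0,C_1,\dots,C_k\}$ of $V(G)$ such that $C_0$ induces a graph in $\tilde{\mathcal{K}}_{n,d-k}$ and each $C_1,\dots,C_k$ is an edge of $G$ consisting of a hub vertex and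 a wing vertex. The deficiency of $G$ is the minimum $k$ for which $G$ has a stretched-clique decomposition with $k$ edges $C_1,\dots,C_k$. -}

module Defs where

open import Data.Nat using (ℕ; zero; suc; _≤_; _∸_)
open import Data.Fin using (Fin; zero; suc; _≟_)
open import Data.Bool using (Bool; true; false; not; if_then_else_; _∨_)
open import Data.Product using (_×_; _,_; ∃-syntax; Σ)
open import Data.List using (List; length)
open import Data.List.Relation.Unary.All using (All)
open import Data.List.Relation.Unary.Unique.Propositional using (Unique)
open import Data.List.Membership.Propositional using (_∈_)
open import Relation.Binary.PropositionalEquality using (_≡_; _≢_)
open import Relation.Nullary.Decidable using (⌊_⌋)

-- A vertex is a pair (i , t) with i ∈ [n] the
-- original vertex it is associated with and t ∈ {0,1,2}.
--   * if i is unstretched, the only present vertex is (i , 0), which is i;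
--   * if i is stretched,  (i , 0) is the hub i₀ and (i , 1), (i , 2) are
--     the wings i₁, i₂.

V : ℕ → Set
V n = Fin n × Fin 3

record State (n : ℕ) : Set where
  field
    stretched : Fin n → Bool
    adj       : V n → V n → Bool
open State public

present : ∀ {n} → State n → V n → Bool
present S (i , zero)  = true
present S (i , suc _) = stretched S i

Kn : (n : ℕ) → State n
Kn n = record
  { stretched = λ _ → false
  ; adj = λ { (i , zero) (j , zero) → not ⌊ i ≟ j ⌋ ; _ _ → false } }

innerAdj : Fin 3 → Fin 3 → Bool
innerAdj zero (suc _) = true
innerAdj (suc _) zero = true
innerAdj _ _ = false

newAdj : ∀ {n} → (V n → Bool) → (V n → Bool) → Fin 3 → V n → Bool
newAdj A₁ A₂ zero w = false
newAdj A₁ A₂ (suc zero) w = A₁ w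
newAdj A₁ A₂ (suc (suc _)) w = A₂ w

stretch : ∀ {n} → State n → Fin n → (V n → Bool) → (V n → Bool) → State n
stretch {n} S i A₁ A₂ = record
  { stretched = λ j → if ⌊ j ≟ i ⌋ then true else stretched S j
  ; adj = adj' }
  where
  adj' : V n → V n → Bool
  adj' (j , s) (k , t) with ⌊ j ≟ i ⌋ | ⌊ k ≟ i ⌋
  ... | true  | true  = innerAdj s t
  ... | true  | false = newAdj A₁ A₂ s (k , t)
  ... | false | true  = newAdj A₁ A₂ t (j , s)
  ... | false | false = adj S (j , s) (k , t)

-- Reach d G : G ∈ 𝒦_{n,d}, i.e. G is obtained from K_n by 2-stretching
-- d of its original vertices (in some order), each at most once.
-- Γ(i) is the neighbourhood of the vertex (i , 0) in the current graph;
-- A₁ , A₂ ⊆ Γ(i) (possibly empty) with A₁ ∪ A₂ = Γ(i).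
data Reach {n : ℕ} : ℕ → State n → Set where
  base : Reach zero (Kn n)
  step : ∀ {d S} → Reach d S → (i : Fin n) → stretched S i ≡ false →
         (A₁ A₂ : V n → Bool) →
         (∀ v → A₁ v ≡ true → adj S (i , zero) v ≡ true) →
         (∀ v → A₂ v ≡ true → adj S (i , zero) v ≡ true) →
         (∀ v → adj S (i , zero) v ≡ true → (A₁ v ∨ A₂ v) ≡ true) →
         Reach (suc d) (stretch S i A₁ A₂)

IsHub : ∀ {n} → State n → V n → Set
IsHub S (i , t) = stretched S i ≡ true × t ≡ zero

IsWing : ∀ {n} → State n → V n → Set
IsWing S (i , t) = stretched S i ≡ true × t ≢ zero

Assoc : ∀ {n} → State n → Fin n → V n → Set
Assoc S j (i , t) = i ≡ j × present S (i , t) ≡ true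

-- G ∈ 𝒦̃ (given G ∈ 𝒦_{n,d}): for each stretched i and wing i_ℓ,
-- Γ̃(i_ℓ) ⊊ [n] ∖ {i}, i.e. some j ≠ i has no associated vertex adjacent to i_ℓ.
Tilde : ∀ {n} → State n → Set
Tilde {n} S = ∀ (i : Fin n) (ℓ : Fin 3) → stretched S i ≡ true → ℓ ≢ zero →
  ∃[ j ] (j ≢ i × (∀ v → Assoc S j v → adj S (i , ℓ) v ≡ false))

-- C_r = {hub r , wing r}; C₀ = all remaining vertices of G.
-- C₀ must induce a graph in 𝒦̃_{n,d-k}: it is isomorphic (via f , g) to
-- some labelled graph T with Reach (d ∸ k) T and Tilde T.
record Decomp {n : ℕ} (G : State n) (d k : ℕ) : Set where
  field
    hub wing   : Fin k → V n
    hubIsHub   : ∀ r → IsHub G (hub r)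
    wingIsWing : ∀ r → IsWing G (wing r)
    isEdge     : ∀ r → adj G (hub r) (wing r) ≡ true
    hubInj     : ∀ r r' → hub r ≡ hub r' → r ≡ r'
    wingInj    : ∀ r r' → wing r ≡ wing r' → r ≡ r'
    hubWing    : ∀ r r' → hub r ≢ wing r'
  InC₀ : V n → Set
  InC₀ v = present G v ≡ true × (∀ r → hub r ≢ v × wing r ≢ v)
  field
    T        : State n
    T-reach  : Reach (d ∸ k) T
    T-tilde  : Tilde T
    f g      : V n → V n
    f-pres   : ∀ v → InC₀ v → present T (f v) ≡ true
    g-pres   : ∀ u → present T u ≡ true → InC₀ (g u)
    gf       : ∀ v → InC₀ v → g (f v) ≡ v
    fg       : ∀ u → present T u ≡ true → f (g u) ≡ u
    adj-pres : ∀ v w → InC₀ v → InC₀ w → adj G v w ≡ adj T (f v) (f w)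

IsClique : ∀ {n} → State n → List (V n) → Set
IsClique G xs = Unique xs × All (λ v → present G v ≡ true) xs ×
  (∀ v w → v ∈ xs → w ∈ xs → v ≢ w → adj G v w ≡ true)

CliqueNumber : ∀ {n} → State n → ℕ → Set
CliqueNumber G ω = (∃[ xs ] (IsClique G xs × length xs ≡ ω)) ×
  (∀ xs → IsClique G xs → length xs ≤ ω)

-- A labelled graph lies in 𝒦_{n,d} exactly when it satisfies five local conditions
-- (IsStretchedClique) and has d stretched vertices: stretching preserves the conditions, and
-- conversely a stretched vertex can be contracted, its hub inheriting the neighbours of both wings.
-- Call a wing i_ℓ full if it is adjacent to a vertex of C₀ associated with every j ≠ i. Greedily
-- collapse stretched vertices i with a full wing i_ℓ: the hub and the other wing of i become an edge
-- C_r, and i_ℓ alone represents i in C₀. Earlier kept wings stay full, since every collapsed j keeps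
-- a single vertex in C₀. When no full wing is left, C₀ relabelled is a graph of 𝒦̃_{n,d-k}. The kept
-- wings of the k collapsed vertices together with the n - d unstretched vertices form a clique of G,
-- so k + n - d ≤ ω(G).

module Submission where

open import Defs
open import Function using (_∘_)
open import Data.Nat using (ℕ; zero; suc; _+_; _∸_; _≤_)
import Data.Nat.Properties as Nat
open import Data.Bool using (Bool; true; false; not; if_then_else_; _∧_; _∨_)
open import Data.Bool.Properties using (¬-not; ∧-zeroʳ; ∨-zeroʳ; ∧-comm; ∧-abs-∨)
import Data.Bool.Properties as Bool using (_≟_)
open import Data.Fin using (Fin; zero; suc; _≟_)
open import Data.Fin.Patterns using (0F; 1F; 2F)
open import Data.Fin.Properties using (suc-injective; 0≢1+n; any?; all?; ¬∀⟶∃¬)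
open import Data.Product using (_×_; _,_; proj₁; proj₂; ∃-syntax)
open import Data.List using (List; []; _∷_; map; length; lookup)
open import Data.List.Properties using (length-map)
open import Data.List.Membership.Propositional using (_∈_)
open import Data.List.Membership.Propositional.Properties using (∈-map⁺; ∈-map⁻; ∈-lookup)
open import Data.List.Relation.Unary.Any as Any using (here; there)
open import Data.List.Relation.Unary.Any.Properties using (lookup-index)
open import Data.List.Relation.Unary.All as All using ()
open import Data.List.Relation.Unary.AllPairs using ([]; _∷_)
open import Data.List.Relation.Unary.Unique.Propositional using (Unique)
import Data.List.Relation.Unary.Unique.Propositional.Properties as Unique
open import Data.Sum using (inj₁; inj₂)
open import Data.Empty using (⊥-elim)
open import Relation.Nullary using (¬_)
open import Relation.Nullary.Decidable using (Dec; ⌊_⌋; yes; no; ¬?; _×-dec_; _→-dec_; toSum)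
open import Relation.Binary.PropositionalEquality

true≢false : true ≢ false
true≢false ()

⌊≟⌋-refl : ∀ {m} (x : Fin m) → ⌊ x ≟ x ⌋ ≡ true
⌊≟⌋-refl x with x ≟ x
... | yes _  = refl
... | no x≢x = ⊥-elim (x≢x refl)

⌊≟⌋⇒≡ : ∀ {m} {x y : Fin m} → ⌊ x ≟ y ⌋ ≡ true → x ≡ y
⌊≟⌋⇒≡ {x = x} {y} e with x ≟ y
... | yes x≡y = x≡y

∧-guard : ∀ {p q a} → (a ≡ true → p ≡ true × q ≡ true) → (p ∧ q) ∧ a ≡ a
∧-guard {a = false} _ = ∧-zeroʳ _
∧-guard {a = true}  h rewrite proj₁ (h refl) | proj₂ (h refl) = refl

∧-elimʳ : ∀ p {a} → p ∧ a ≡ true → a ≡ true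
∧-elimʳ true  e = e
∧-elimʳ false ()

isZero : Fin 3 → Bool
isZero 0F      = true
isZero (suc _) = false

isZero-≢0 : ∀ {ℓ} → ℓ ≢ 0F → isZero ℓ ≡ false
isZero-≢0 {0F}    ℓ≢0 = ⊥-elim (ℓ≢0 refl)
isZero-≢0 {suc _} _   = refl

-- Counting the true points of a predicate on Fin n

count : ∀ {n} → (Fin n → Bool) → ℕ
count {zero}  p = 0
count {suc n} p = if p zero then suc (count (p ∘ suc)) else count (p ∘ suc)

count-cong : ∀ {n} {p q : Fin n → Bool} → (∀ i → p i ≡ q i) → count p ≡ count q
count-cong {zero}          h = refl
count-cong {suc n} {p} {q} h with p zero | q zero | h zero
... | true  | .true  | refl = cong suc (count-cong (h ∘ suc))
... | false | .false | refl = count-cong (h ∘ suc)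

none⇒count≡0 : ∀ {n} {p : Fin n → Bool} → (∀ i → p i ≡ false) → count p ≡ 0
none⇒count≡0 {zero}      h = refl
none⇒count≡0 {suc n} {p} h rewrite h zero = none⇒count≡0 (h ∘ suc)

count≡0⇒none : ∀ {n} {p : Fin n → Bool} → count p ≡ 0 → ∀ i → p i ≡ false
count≡0⇒none {suc n} {p} c i with p zero in p0 | i
... | true  | _      = ⊥-elim (Nat.1+n≢0 c)
... | false | zero   = p0
... | false | suc i′ = count≡0⇒none c i′

count-insert : ∀ {n} {p q : Fin n → Bool} a → p a ≡ false → q a ≡ true →
               (∀ j → j ≢ a → q j ≡ p j) → count q ≡ suc (count p)
count-insert {suc n} {p} {q} zero pa qa h rewrite pa | qa =
  cong suc (count-cong (λ j → h (suc j) (λ ())))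
count-insert {suc n} {p} {q} (suc a) pa qa h rewrite h zero (λ ()) with p zero
... | true  = cong suc (count-insert a pa qa (λ j j≢a → h (suc j) (j≢a ∘ suc-injective)))
... | false = count-insert a pa qa (λ j j≢a → h (suc j) (j≢a ∘ suc-injective))

count≡suc⇒∃ : ∀ {n m} {p : Fin n → Bool} → count p ≡ suc m → ∃[ a ] p a ≡ true
count≡suc⇒∃ {suc n} {p = p} c with p zero in pz
... | true  = zero , pz
... | false = let a , pa = count≡suc⇒∃ c in suc a , pa

count-∧-split : ∀ {n} (p q : Fin n → Bool) →
                count q ≡ count (λ i → p i ∧ q i) + count (λ i → not (p i) ∧ q i)
count-∧-split {zero}  p q = refl
count-∧-split {suc n} p q with p zero | q zero
... | true  | true  = cong suc (count-∧-split (p ∘ suc) (q ∘ suc))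
... | false | true  = trans (cong suc (count-∧-split (p ∘ suc) (q ∘ suc))) (sym (Nat.+-suc _ _))
... | true  | false = count-∧-split (p ∘ suc) (q ∘ suc)
... | false | false = count-∧-split (p ∘ suc) (q ∘ suc)

count-complement : ∀ {n} (p : Fin n → Bool) → count p + count (not ∘ p) ≡ n
count-complement {zero}  p = refl
count-complement {suc n} p with p zero
... | true  = cong suc (count-complement (p ∘ suc))
... | false = trans (Nat.+-suc _ _) (cong suc (count-complement (p ∘ suc)))

select : ∀ {n} → (Fin n → Bool) → List (Fin n)
select {zero}  p = []
select {suc n} p = if p zero then zero ∷ rest else rest
  where rest = map suc (select (p ∘ suc))

length-select : ∀ {n} (p : Fin n → Bool) → length (select p) ≡ count p
length-select {zero}  p = refl
length-select {suc n} p with p zero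
... | true  = cong suc (trans (length-map suc (select (p ∘ suc))) (length-select (p ∘ suc)))
... | false = trans (length-map suc (select (p ∘ suc))) (length-select (p ∘ suc))

∈-select⁻ : ∀ {n} (p : Fin n → Bool) {i} → i ∈ select p → p i ≡ true
∈-select⁻ {suc n} p i∈ with p zero in pz
∈-select⁻ {suc n} p (here refl) | true = pz
∈-select⁻ {suc n} p (there i∈) | true with ∈-map⁻ suc i∈
... | j , j∈ , refl = ∈-select⁻ (p ∘ suc) j∈
∈-select⁻ {suc n} p i∈ | false with ∈-map⁻ suc i∈
... | j , j∈ , refl = ∈-select⁻ (p ∘ suc) j∈

∈-select⁺ : ∀ {n} (p : Fin n → Bool) {i} → p i ≡ true → i ∈ select p
∈-select⁺ {suc n} p {zero} pi with p zero
∈-select⁺ {suc n} p {zero} refl | true = here refl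
∈-select⁺ {suc n} p {suc i} pi with p zero
... | true  = there (∈-map⁺ suc (∈-select⁺ (p ∘ suc) pi))
... | false = ∈-map⁺ suc (∈-select⁺ (p ∘ suc) pi)

select-unique : ∀ {n} (p : Fin n → Bool) → Unique (select p)
select-unique {zero}  p = []
select-unique {suc n} p with p zero
... | true  = All.tabulate zero∉ ∷ Unique.map⁺ suc-injective (select-unique (p ∘ suc))
  where
  zero∉ : ∀ {i} → i ∈ map suc (select (p ∘ suc)) → zero ≢ i
  zero∉ i∈ refl with ∈-map⁻ suc i∈
  ... | _ , _ , ()
... | false = Unique.map⁺ suc-injective (select-unique (p ∘ suc))

lookup-injective : ∀ {A : Set} {xs : List A} → Unique xs →
                   ∀ r r' → lookup xs r ≡ lookup xs r' → r ≡ r'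
lookup-injective (_ ∷ _)        zero    zero     _ = refl
lookup-injective (x∉ ∷ _)       zero    (suc r') e = ⊥-elim (All.lookup x∉ (∈-lookup r') e)
lookup-injective (x∉ ∷ _)       (suc r) zero     e = ⊥-elim (All.lookup x∉ (∈-lookup r) (sym e))
lookup-injective (_ ∷ distinct) (suc r) (suc r') e = cong suc (lookup-injective distinct r r' e)

-- Stretched cliques

Linked : ∀ {n} → State n → Fin n → Fin n → Set
Linked G i j = ∃[ s ] ∃[ t ] adj G (i , s) (j , t) ≡ true

record IsStretchedClique {n} (G : State n) : Set where
  field
    adj-sym     : ∀ u v → adj G u v ≡ adj G v u
    adj-absent  : ∀ u v → present G u ≡ false → adj G u v ≡ false
    adj-within  : ∀ i s t → adj G (i , s) (i , t) ≡ (stretched G i ∧ innerAdj s t)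
    hub-private : ∀ i j t → stretched G i ≡ true → i ≢ j → adj G (i , 0F) (j , t) ≡ false
    linked      : ∀ i j → i ≢ j → Linked G i j

record _≋_ {n} (S T : State n) : Set where
  field
    stretched-≗ : ∀ i → stretched S i ≡ stretched T i
    adj-≗       : ∀ u v → adj S u v ≡ adj T u v

present-≋ : ∀ {n} {S T : State n} → S ≋ T → ∀ v → present S v ≡ present T v
present-≋ S≋T (i , 0F)    = refl
present-≋ S≋T (i , suc _) = _≋_.stretched-≗ S≋T i

Tilde-≋ : ∀ {n} {S T : State n} → S ≋ T → Tilde T → Tilde S
Tilde-≋ S≋T tilde i ℓ i-stretched ℓ≢0 =
  let j , j≢i , non-adjacent = tilde i ℓ (trans (sym (stretched-≗ i)) i-stretched) ℓ≢0 in
  j , j≢i , λ v (v-j , v-present) →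
    trans (adj-≗ _ v) (non-adjacent v (v-j , trans (sym (present-≋ S≋T v)) v-present))
  where open _≋_ S≋T

innerAdj-sym : ∀ s t → innerAdj s t ≡ innerAdj t s
innerAdj-sym 0F      0F      = refl
innerAdj-sym 0F      (suc t) = refl
innerAdj-sym (suc s) 0F      = refl
innerAdj-sym (suc s) (suc t) = refl

stretched-stretch-≡ : ∀ {n} (S : State n) i A₁ A₂ → stretched (stretch S i A₁ A₂) i ≡ true
stretched-stretch-≡ S i A₁ A₂ with i ≟ i
... | yes _  = refl
... | no i≢i = ⊥-elim (i≢i refl)

stretched-stretch-≢ : ∀ {n} (S : State n) {i j} A₁ A₂ → j ≢ i →
                      stretched (stretch S i A₁ A₂) j ≡ stretched S j
stretched-stretch-≢ S {i} {j} A₁ A₂ j≢i with j ≟ i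
... | yes j≡i = ⊥-elim (j≢i j≡i)
... | no _    = refl

module _ {n} {G : State n} (G-sc : IsStretchedClique G) where
  open IsStretchedClique G-sc

  adj⇒presentˡ : ∀ u v → adj G u v ≡ true → present G u ≡ true
  adj⇒presentˡ u v e = ¬-not λ u-absent → true≢false (trans (sym e) (adj-absent u v u-absent))

  adj⇒presentʳ : ∀ u v → adj G u v ≡ true → present G v ≡ true
  adj⇒presentʳ u v e = adj⇒presentˡ v u (trans (adj-sym v u) e)

Kn-isStretchedClique : ∀ n → IsStretchedClique (Kn n)
Kn-isStretchedClique n = record
  { adj-sym = sym′ ; adj-absent = absent ; adj-within = within
  ; hub-private = λ _ _ _ () ; linked = λ i j i≢j → 0F , 0F , distinct-adjacent i≢j }
  where
  sym′ : ∀ u v → adj (Kn n) u v ≡ adj (Kn n) v u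
  sym′ (i , 0F)    (j , 0F)    with i ≟ j | j ≟ i
  ... | yes _   | yes _   = refl
  ... | no _    | no _    = refl
  ... | yes i≡j | no j≢i  = ⊥-elim (j≢i (sym i≡j))
  ... | no i≢j  | yes j≡i = ⊥-elim (i≢j (sym j≡i))
  sym′ (i , 0F)    (j , suc _) = refl
  sym′ (i , suc _) (j , 0F)    = refl
  sym′ (i , suc _) (j , suc _) = refl
  absent : ∀ u v → present (Kn n) u ≡ false → adj (Kn n) u v ≡ false
  absent (i , suc _) (j , 0F)    _ = refl
  absent (i , suc _) (j , suc _) _ = refl
  within : ∀ i s t → adj (Kn n) (i , s) (i , t) ≡ false
  within i 0F      0F      with i ≟ i
  ... | yes _  = refl
  ... | no i≢i = ⊥-elim (i≢i refl)
  within i 0F      (suc _) = refl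
  within i (suc _) 0F      = refl
  within i (suc _) (suc _) = refl
  distinct-adjacent : ∀ {i j} → i ≢ j → adj (Kn n) (i , 0F) (j , 0F) ≡ true
  distinct-adjacent {i} {j} i≢j with i ≟ j
  ... | yes i≡j = ⊥-elim (i≢j i≡j)
  ... | no _    = refl

module Stretching {n} {S : State n} (S-sc : IsStretchedClique S) {i : Fin n}
  (i-unstretched : stretched S i ≡ false) {A₁ A₂ : V n → Bool}
  (A₁⊆Γ : ∀ v → A₁ v ≡ true → adj S (i , 0F) v ≡ true)
  (A₂⊆Γ : ∀ v → A₂ v ≡ true → adj S (i , 0F) v ≡ true)
  (Γ⊆A₁∪A₂ : ∀ v → adj S (i , 0F) v ≡ true → (A₁ v ∨ A₂ v) ≡ true) where

  open IsStretchedClique S-sc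

  isStretchedClique : IsStretchedClique (stretch S i A₁ A₂)
  isStretchedClique = record
    { adj-sym     = sym′
    ; adj-absent  = absent′
    ; adj-within  = within′
    ; hub-private = hub-private′
    ; linked      = linked′ }
    where
    S′ : State n
    S′ = stretch S i A₁ A₂

    newAdj-non-neighbour : ∀ t v → adj S v (i , 0F) ≡ false → newAdj A₁ A₂ t v ≡ false
    newAdj-non-neighbour 0F v _ = refl
    newAdj-non-neighbour 1F v e =
      ¬-not λ A₁v → true≢false (trans (sym (A₁⊆Γ v A₁v)) (trans (adj-sym _ _) e))
    newAdj-non-neighbour 2F v e =
      ¬-not λ A₂v → true≢false (trans (sym (A₂⊆Γ v A₂v)) (trans (adj-sym _ _) e))

    sym′ : ∀ u v → adj S′ u v ≡ adj S′ v u
    sym′ (j , s) (k , t) with j ≟ i | k ≟ i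
    ... | yes _ | yes _ = innerAdj-sym s t
    ... | yes _ | no _  = refl
    ... | no _  | yes _ = refl
    ... | no _  | no _  = adj-sym _ _

    absent′ : ∀ u v → present S′ u ≡ false → adj S′ u v ≡ false
    absent′ (j , suc x) (k , t) j-absent with j ≟ i
    ... | yes refl = ⊥-elim (true≢false j-absent)
    ... | no _ with k ≟ i
    ...   | yes refl = newAdj-non-neighbour t _ (adj-absent _ _ j-absent)
    ...   | no _     = adj-absent _ _ j-absent

    within′ : ∀ j s t → adj S′ (j , s) (j , t) ≡ (stretched S′ j ∧ innerAdj s t)
    within′ j s t with j ≟ i
    ... | yes refl = refl
    ... | no _     = adj-within j s t

    hub-private′ : ∀ j k t → stretched S′ j ≡ true → j ≢ k → adj S′ (j , 0F) (k , t) ≡ false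
    hub-private′ j k t j-stretched j≢k with j ≟ i | k ≟ i
    ... | yes refl | yes refl = ⊥-elim (j≢k refl)
    ... | yes refl | no _     = refl
    ... | no _     | yes refl = newAdj-non-neighbour t _ (hub-private j i 0F j-stretched j≢k)
    ... | no _     | no _     = hub-private j k t j-stretched j≢k

    -- i is unstretched in S, so S joins k to the hub i₀, and the wings share i₀'s neighbours.
    wing-reaches : ∀ k → k ≢ i → ∃[ s ] ∃[ t ] newAdj A₁ A₂ s (k , t) ≡ true
    wing-reaches k k≢i with linked k i k≢i
    ... | x , suc y , e = ⊥-elim (true≢false (trans (sym (adj⇒presentʳ S-sc _ _ e)) i-unstretched))
    ... | x , 0F    , e with Γ⊆A₁∪A₂ _ (trans (adj-sym _ _) e)
    ...   | A₁∨A₂ with A₁ (k , x) in A₁kx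
    ...     | true  = 1F , x , A₁kx
    ...     | false = 2F , x , A₁∨A₂

    linked′ : ∀ j k → j ≢ k → Linked S′ j k
    linked′ j k j≢k with j ≟ i | k ≟ i
    ... | yes refl | yes refl = ⊥-elim (j≢k refl)
    ... | yes refl | no k≢i   = wing-reaches k k≢i
    ... | no j≢i   | yes refl = let s , t , e = wing-reaches j j≢i in t , s , e
    ... | no _     | no _     = linked j k j≢k

reach⇒isStretchedClique : ∀ {n d} {G : State n} → Reach d G → IsStretchedClique G
reach⇒isStretchedClique base = Kn-isStretchedClique _
reach⇒isStretchedClique (step r i i-unstretched A₁ A₂ A₁⊆Γ A₂⊆Γ Γ⊆A₁∪A₂) =
  Stretching.isStretchedClique (reach⇒isStretchedClique r) i-unstretched A₁⊆Γ A₂⊆Γ Γ⊆A₁∪A₂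

reach⇒count : ∀ {n d} {G : State n} → Reach d G → count (stretched G) ≡ d
reach⇒count {n} base = none⇒count≡0 {n} (λ _ → refl)
reach⇒count (step {S = S} r i i-unstretched A₁ A₂ _ _ _) =
  trans (count-insert i i-unstretched (stretched-stretch-≡ S i A₁ A₂)
                      (λ j j≢i → stretched-stretch-≢ S A₁ A₂ j≢i))
        (cong suc (reach⇒count r))

Kn-≋ : ∀ {n} {S : State n} → IsStretchedClique S → (∀ i → stretched S i ≡ false) → Kn n ≋ S
Kn-≋ {n} {S} S-sc unstretched = record
  { stretched-≗ = λ i → sym (unstretched i) ; adj-≗ = adj-≗ }
  where
  open IsStretchedClique S-sc
  adj-≗ : ∀ u v → adj (Kn n) u v ≡ adj S u v
  adj-≗ (i , suc _) v           = sym (adj-absent _ v (unstretched i))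
  adj-≗ (i , 0F)    (j , suc _) = sym (trans (adj-sym _ _) (adj-absent _ _ (unstretched j)))
  adj-≗ (i , 0F)    (j , 0F)    with i ≟ j
  ... | yes refl = sym (trans (adj-within i 0F 0F) (cong (_∧ false) (unstretched i)))
  ... | no i≢j with linked i j i≢j
  ...   | 0F    , 0F    , e = sym e
  ...   | suc _ , _     , e = ⊥-elim (true≢false (trans (sym (adj⇒presentˡ S-sc _ _ e)) (unstretched i)))
  ...   | 0F    , suc _ , e = ⊥-elim (true≢false (trans (sym (adj⇒presentʳ S-sc _ _ e)) (unstretched j)))

module Contraction {n} {S : State n} (S-sc : IsStretchedClique S) {a : Fin n}
  (a-stretched : stretched S a ≡ true) where

  open IsStretchedClique S-sc

  joinedToWings : V n → Bool
  joinedToWings v = adj S (a , 1F) v ∨ adj S (a , 2F) v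

  contractAdj : V n → V n → Bool
  contractAdj (j , s) (k , t) with ⌊ j ≟ a ⌋ | ⌊ k ≟ a ⌋
  ... | true  | true  = false
  ... | true  | false = isZero s ∧ joinedToWings (k , t)
  ... | false | true  = isZero t ∧ joinedToWings (j , s)
  ... | false | false = adj S (j , s) (k , t)

  contracted : State n
  contracted = record
    { stretched = λ j → if ⌊ j ≟ a ⌋ then false else stretched S j
    ; adj       = contractAdj }

  stretched-contracted-≡ : stretched contracted a ≡ false
  stretched-contracted-≡ with a ≟ a
  ... | yes _  = refl
  ... | no a≢a = ⊥-elim (a≢a refl)

  stretched-contracted-≢ : ∀ {j} → j ≢ a → stretched contracted j ≡ stretched S j
  stretched-contracted-≢ {j} j≢a with j ≟ a
  ... | yes j≡a = ⊥-elim (j≢a j≡a)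
  ... | no _    = refl

  adj-contracted-≢≢ : ∀ {j k s t} → j ≢ a → k ≢ a →
                      adj contracted (j , s) (k , t) ≡ adj S (j , s) (k , t)
  adj-contracted-≢≢ {j} {k} j≢a k≢a with j ≟ a | k ≟ a
  ... | no _    | no _    = refl
  ... | yes j≡a | _       = ⊥-elim (j≢a j≡a)
  ... | no _    | yes k≡a = ⊥-elim (k≢a k≡a)

  count-contracted : count (stretched S) ≡ suc (count (stretched contracted))
  count-contracted = count-insert a stretched-contracted-≡ a-stretched (λ _ → sym ∘ stretched-contracted-≢)

  joinedToWings-absent : ∀ v → present S v ≡ false → joinedToWings v ≡ false
  joinedToWings-absent v v-absent =
    cong₂ _∨_ (trans (adj-sym _ _) (adj-absent v _ v-absent)) (trans (adj-sym _ _) (adj-absent v _ v-absent))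

  joinedToWings-intro : ∀ ℓ v → ℓ ≢ 0F → adj S (a , ℓ) v ≡ true → joinedToWings v ≡ true
  joinedToWings-intro 0F v ℓ≢0 _ = ⊥-elim (ℓ≢0 refl)
  joinedToWings-intro 1F v _   e = cong (_∨ adj S (a , 2F) v) e
  joinedToWings-intro 2F v _   e = trans (cong (adj S (a , 1F) v ∨_) e) (∨-zeroʳ _)

  isStretchedClique : IsStretchedClique contracted
  isStretchedClique = record
    { adj-sym = sym′ ; adj-absent = absent′ ; adj-within = within′
    ; hub-private = hub-private′ ; linked = linked′ }
    where
    sym′ : ∀ u v → contractAdj u v ≡ contractAdj v u
    sym′ (j , s) (k , t) with j ≟ a | k ≟ a
    ... | yes _ | yes _ = refl
    ... | yes _ | no _  = refl
    ... | no _  | yes _ = refl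
    ... | no _  | no _  = adj-sym _ _

    absent′ : ∀ u v → present contracted u ≡ false → contractAdj u v ≡ false
    absent′ (j , suc x) (k , t) j-absent with j ≟ a | k ≟ a
    ... | yes _ | yes _ = refl
    ... | yes _ | no _  = refl
    ... | no _  | yes _ = trans (cong (isZero t ∧_) (joinedToWings-absent _ j-absent)) (∧-zeroʳ _)
    ... | no _  | no _  = adj-absent _ _ j-absent

    within′ : ∀ j s t → contractAdj (j , s) (j , t) ≡ (stretched contracted j ∧ innerAdj s t)
    within′ j s t with j ≟ a
    ... | yes _ = refl
    ... | no _  = adj-within j s t

    hub-private′ : ∀ j k t → stretched contracted j ≡ true → j ≢ k →
                   contractAdj (j , 0F) (k , t) ≡ false
    hub-private′ j k t j-stretched j≢k with j ≟ a | k ≟ a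
    ... | yes _    | _        = ⊥-elim (true≢false (sym j-stretched))
    ... | no _     | yes refl = trans (cong (isZero t ∧_)
                                  (cong₂ _∨_ (trans (adj-sym _ _) (hub-private j a 1F j-stretched j≢k))
                                             (trans (adj-sym _ _) (hub-private j a 2F j-stretched j≢k))))
                                  (∧-zeroʳ _)
    ... | no _     | no _     = hub-private j k t j-stretched j≢k

    -- The hub a₀ has no neighbours outside a, so a wing of a carries the link from a to k.
    hub-reaches : ∀ k → k ≢ a → ∃[ t ] joinedToWings (k , t) ≡ true
    hub-reaches k k≢a with linked a k (k≢a ∘ sym)
    ... | 0F    , t , e = ⊥-elim (true≢false (trans (sym e) (hub-private a k t a-stretched (k≢a ∘ sym))))
    ... | suc x , t , e = t , joinedToWings-intro (suc x) _ (λ ()) e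

    linked′ : ∀ j k → j ≢ k → Linked contracted j k
    linked′ j k j≢k with j ≟ a | k ≟ a
    ... | yes refl | yes refl = ⊥-elim (j≢k refl)
    ... | yes refl | no k≢a   = let t , e = hub-reaches k k≢a in 0F , t , e
    ... | no j≢a   | yes refl = let t , e = hub-reaches j j≢a in t , 0F , e
    ... | no _     | no _     = linked j k j≢k

  wingNeighbours : Fin 3 → V n → Bool
  wingNeighbours ℓ (k , t) = if ⌊ k ≟ a ⌋ then false else adj S (a , ℓ) (k , t)

  wingNeighbours-⊆ : ∀ ℓ → ℓ ≢ 0F → ∀ v → wingNeighbours ℓ v ≡ true → adj contracted (a , 0F) v ≡ true
  wingNeighbours-⊆ ℓ ℓ≢0 (k , t) e with a ≟ a | k ≟ a
  ... | no a≢a | _     = ⊥-elim (a≢a refl)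
  ... | yes _  | yes _ = ⊥-elim (true≢false (sym e))
  ... | yes _  | no _  = joinedToWings-intro ℓ _ ℓ≢0 e

  wingNeighbours-⊇ : ∀ v → adj contracted (a , 0F) v ≡ true →
                     (wingNeighbours 1F v ∨ wingNeighbours 2F v) ≡ true
  wingNeighbours-⊇ (k , t) e with a ≟ a | k ≟ a
  ... | no a≢a | _     = ⊥-elim (a≢a refl)
  ... | yes _  | yes _ = ⊥-elim (true≢false (sym e))
  ... | yes _  | no _  = e

  newAdj-wingNeighbours : ∀ s {k} t → k ≢ a →
    newAdj (wingNeighbours 1F) (wingNeighbours 2F) s (k , t) ≡ adj S (a , s) (k , t)
  newAdj-wingNeighbours 0F t k≢a = sym (hub-private a _ t a-stretched (k≢a ∘ sym))
  newAdj-wingNeighbours 1F {k} t k≢a with k ≟ a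
  ... | yes k≡a = ⊥-elim (k≢a k≡a)
  ... | no _    = refl
  newAdj-wingNeighbours 2F {k} t k≢a with k ≟ a
  ... | yes k≡a = ⊥-elim (k≢a k≡a)
  ... | no _    = refl

  restretch-≋ : ∀ {T} → T ≋ contracted → stretch T a (wingNeighbours 1F) (wingNeighbours 2F) ≋ S
  restretch-≋ {T} T≋ = record { stretched-≗ = stretched-≗ ; adj-≗ = adj-≗ }
    where
    module T≋ = _≋_ T≋
    stretched-≗ : ∀ j → stretched (stretch T a (wingNeighbours 1F) (wingNeighbours 2F)) j ≡ stretched S j
    stretched-≗ j with j ≟ a
    ... | yes refl = sym a-stretched
    ... | no j≢a   = trans (T≋.stretched-≗ j) (stretched-contracted-≢ j≢a)
    adj-≗ : ∀ u v → adj (stretch T a (wingNeighbours 1F) (wingNeighbours 2F)) u v ≡ adj S u v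
    adj-≗ (j , s) (k , t) with j ≟ a | k ≟ a
    ... | yes refl | yes refl = sym (trans (adj-within a s t) (cong (_∧ innerAdj s t) a-stretched))
    ... | yes refl | no k≢a   = newAdj-wingNeighbours s t k≢a
    ... | no j≢a   | yes refl = trans (newAdj-wingNeighbours t s j≢a) (adj-sym _ _)
    ... | no j≢a   | no k≢a   = trans (T≋.adj-≗ _ _) (adj-contracted-≢≢ j≢a k≢a)

isStretchedClique⇒reach : ∀ m {n} {S : State n} → IsStretchedClique S → count (stretched S) ≡ m →
                          ∃[ T ] (Reach m T × T ≋ S)
isStretchedClique⇒reach zero    {n} S-sc none = Kn n , base , Kn-≋ S-sc (count≡0⇒none none)
isStretchedClique⇒reach (suc m) {n} S-sc c with count≡suc⇒∃ c
... | a , a-stretched =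
  stretch T a A₁ A₂ ,
  step T-reach a (trans (T≋.stretched-≗ a) stretched-contracted-≡) A₁ A₂
       (λ v A₁v → trans (T≋.adj-≗ _ v) (wingNeighbours-⊆ 1F (λ ()) v A₁v))
       (λ v A₂v → trans (T≋.adj-≗ _ v) (wingNeighbours-⊆ 2F (λ ()) v A₂v))
       (λ v e → wingNeighbours-⊇ v (trans (sym (T≋.adj-≗ _ v)) e)) ,
  restretch-≋ T≋
  where
  open Contraction S-sc a-stretched
  A₁ A₂ : V n → Bool
  A₁ = wingNeighbours 1F
  A₂ = wingNeighbours 2F
  IH : ∃[ T ] (Reach m T × T ≋ contracted)
  IH = isStretchedClique⇒reach m isStretchedClique (Nat.suc-injective (trans (sym count-contracted) c))
  T : State n
  T = proj₁ IH
  T-reach : Reach m T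
  T-reach = proj₁ (proj₂ IH)
  T≋ : T ≋ contracted
  T≋ = proj₂ (proj₂ IH)
  module T≋ = _≋_ T≋

-- Collapsing stretched vertices

otherWing : Fin 3 → Fin 3
otherWing 1F = 2F
otherWing _  = 1F

otherWing≢0 : ∀ {x} → otherWing x ≢ 0F
otherWing≢0 {0F}    ()
otherWing≢0 {1F}    ()
otherWing≢0 {2F}    ()

innerAdj-otherWing : ∀ x → innerAdj 0F (otherWing x) ≡ true
innerAdj-otherWing 0F = refl
innerAdj-otherWing 1F = refl
innerAdj-otherWing 2F = refl

otherWing≢self : ∀ {x} → x ≢ 0F → otherWing x ≢ x
otherWing≢self {0F} x≢0 _ = x≢0 refl
otherWing≢self {1F} _   ()
otherWing≢self {2F} _   ()

remaining-wing : ∀ {x t} → x ≢ 0F → t ≢ 0F → t ≢ otherWing x → t ≡ x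
remaining-wing {0F}            x≢0 _   _   = ⊥-elim (x≢0 refl)
remaining-wing {1F} {0F}       _   t≢0 _   = ⊥-elim (t≢0 refl)
remaining-wing {1F} {1F}       _   _   _   = refl
remaining-wing {1F} {2F}       _   _   t≢o = ⊥-elim (t≢o refl)
remaining-wing {2F} {0F}       _   t≢0 _   = ⊥-elim (t≢0 refl)
remaining-wing {2F} {1F}       _   _   t≢o = ⊥-elim (t≢o refl)
remaining-wing {2F} {2F}       _   _   _   = refl

module Decomposition {n} {G : State n} (G-sc : IsStretchedClique G) where

  open IsStretchedClique G-sc

  -- rep i ≢ 0F: i is collapsed, its hub and its other wing form one of the edges C₁..C_k, and the
  -- wing i_(rep i) is the only vertex of i left in C₀.  rep i ≡ 0F: all vertices of i stay in C₀.
  module Representatives (rep : Fin n → Fin 3) where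

    inC₀ : V n → Bool
    inC₀ (j , t) = if isZero (rep j) then present G (j , t) else ⌊ t ≟ rep j ⌋

    FullAt : Fin n → Fin 3 → Fin n → Set
    FullAt i ℓ j = j ≢ i → ∃[ t ] (inC₀ (j , t) ≡ true × adj G (i , ℓ) (j , t) ≡ true)

    Full : Fin n → Fin 3 → Set
    Full i ℓ = ∀ j → FullAt i ℓ j

    Sound : Set
    Sound = ∀ i → rep i ≢ 0F → stretched G i ≡ true × Full i (rep i)

    Collapsible : Fin n → Fin 3 → Set
    Collapsible i ℓ = stretched G i ≡ true × rep i ≡ 0F × ℓ ≢ 0F × Full i ℓ

    Saturated : Set
    Saturated = ∀ i ℓ → ¬ Collapsible i ℓ

    pending : Fin n → Bool
    pending i = isZero (rep i) ∧ stretched G i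

    pending⇒uncollapsed : ∀ {i} → pending i ≡ true → rep i ≡ 0F × stretched G i ≡ true
    pending⇒uncollapsed {i} i-pending with rep i
    ... | 0F    = refl , i-pending
    ... | suc _ = ⊥-elim (true≢false (sym i-pending))

    inC₀-rep : ∀ j → inC₀ (j , rep j) ≡ true
    inC₀-rep j with rep j
    ... | 0F    = refl
    ... | suc l = ⌊≟⌋-refl (suc l)

    inC₀-collapsed : ∀ {j t} → rep j ≢ 0F → inC₀ (j , t) ≡ true → t ≡ rep j
    inC₀-collapsed {j} rep≢0 t∈ with rep j
    ... | 0F    = ⊥-elim (rep≢0 refl)
    ... | suc l = ⌊≟⌋⇒≡ t∈

    inC₀-uncollapsed : ∀ {j t} → rep j ≡ 0F → inC₀ (j , t) ≡ present G (j , t)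
    inC₀-uncollapsed rep≡0 rewrite rep≡0 = refl

    fullAt? : ∀ i ℓ j → Dec (FullAt i ℓ j)
    fullAt? i ℓ j = ¬? (j ≟ i) →-dec
                    any? λ t → (inC₀ (j , t) Bool.≟ true) ×-dec (adj G (i , ℓ) (j , t) Bool.≟ true)

    collapsible? : ∀ i ℓ → Dec (Collapsible i ℓ)
    collapsible? i ℓ =
      (stretched G i Bool.≟ true) ×-dec (rep i ≟ 0F) ×-dec ¬? (ℓ ≟ 0F) ×-dec all? (fullAt? i ℓ)

  open Representatives

  collapse : (Fin n → Fin 3) → Fin n → Fin 3 → Fin n → Fin 3
  collapse rep i ℓ j = if ⌊ j ≟ i ⌋ then ℓ else rep j

  module _ {rep : Fin n → Fin 3} {i : Fin n} where

    collapse-≡ : ∀ {ℓ} → collapse rep i ℓ i ≡ ℓ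
    collapse-≡ with i ≟ i
    ... | yes _  = refl
    ... | no i≢i = ⊥-elim (i≢i refl)

    collapse-≢ : ∀ {ℓ j} → j ≢ i → collapse rep i ℓ j ≡ rep j
    collapse-≢ {j = j} j≢i with j ≟ i
    ... | yes j≡i = ⊥-elim (j≢i j≡i)
    ... | no _    = refl

    inC₀-collapse-≢ : ∀ {ℓ k t} → k ≢ i → inC₀ (collapse rep i ℓ) (k , t) ≡ inC₀ rep (k , t)
    inC₀-collapse-≢ {k = k} k≢i with k ≟ i
    ... | yes k≡i = ⊥-elim (k≢i k≡i)
    ... | no _    = refl

    -- Collapsing i onto its full wing i_ℓ keeps every other collapsed wing j full: the single
    -- vertex of j in C₀ is j_(rep j), so fullness of i_ℓ makes it adjacent to i_ℓ.
    collapse-sound : ∀ {ℓ} → Sound rep → Collapsible rep i ℓ → Sound (collapse rep i ℓ)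
    collapse-sound {ℓ} sound (i-stretched , _ , _ , i-full) j rep′≢0 with j ≟ i
    ... | yes refl = i-stretched , λ k k≢i →
                       let t , t∈ , e = i-full k k≢i in t , trans (inC₀-collapse-≢ k≢i) t∈ , e
    ... | no j≢i   = proj₁ (sound j rep′≢0) , j-full′
      where
      j-full′ : Full (collapse rep i ℓ) j (rep j)
      j-full′ k k≢j with toSum (k ≟ i)
      ... | inj₁ refl = ℓ , ℓ∈ , ℓ-adj
        where
        ℓ∈ : inC₀ (collapse rep i ℓ) (i , ℓ) ≡ true
        ℓ∈ = subst (λ r → inC₀ (collapse rep i ℓ) (i , r) ≡ true) collapse-≡ (inC₀-rep (collapse rep i ℓ) i)
        ℓ-adj : adj G (j , rep j) (i , ℓ) ≡ true
        ℓ-adj = let t , t∈ , e = i-full j j≢i in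
                trans (adj-sym _ _)
                      (subst (λ t → adj G (i , ℓ) (j , t) ≡ true) (inC₀-collapsed rep rep′≢0 t∈) e)
      ... | inj₂ k≢i  = let t , t∈ , e = proj₂ (sound j rep′≢0) k k≢j in
                       t , trans (inC₀-collapse-≢ k≢i) t∈ , e

    count-pending-collapse : ∀ {ℓ} → Collapsible rep i ℓ →
                             count (pending rep) ≡ suc (count (pending (collapse rep i ℓ)))
    count-pending-collapse {ℓ} (i-stretched , rep≡0 , ℓ≢0 , _) =
      count-insert i pending′-i pending-i
                   (λ j j≢i → cong (λ r → isZero r ∧ stretched G j) (sym (collapse-≢ j≢i)))
      where
      pending-i : pending rep i ≡ true
      pending-i rewrite rep≡0 = i-stretched
      pending′-i : pending (collapse rep i ℓ) i ≡ false
      pending′-i = cong (_∧ stretched G i) (trans (cong isZero collapse-≡) (isZero-≢0 ℓ≢0))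

  saturate : ∀ m rep → Sound rep → count (pending rep) ≡ m → ∃[ rep′ ] (Sound rep′ × Saturated rep′)
  saturate m rep sound c with any? (λ i → any? (collapsible? rep i))
  ... | no none = rep , sound , λ i ℓ cl → none (i , ℓ , cl)
  ... | yes (i , ℓ , cl) with m
  ...   | zero   = ⊥-elim (Nat.1+n≢0 (trans (sym (count-pending-collapse cl)) c))
  ...   | suc m′ = saturate m′ (collapse rep i ℓ) (collapse-sound sound cl)
                     (Nat.suc-injective (trans (sym (count-pending-collapse cl)) c))

  sound-saturated : ∃[ rep ] (Sound rep × Saturated rep)
  sound-saturated = saturate _ (λ _ → 0F) (λ _ 0≢0 → ⊥-elim (0≢0 refl)) refl

  module Core {rep : Fin n → Fin 3} (sound : Sound rep) (saturated : Saturated rep) where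

    collapsed⇒stretched : ∀ i → rep i ≢ 0F → stretched G i ≡ true
    collapsed⇒stretched i rep≢0 = proj₁ (sound i rep≢0)

    pick : Fin 3 → Fin 3 → Fin 3
    pick 0F      t = t
    pick (suc l) _ = suc l

    drop : Fin 3 → Fin 3 → Fin 3
    drop 0F      t = t
    drop (suc _) _ = 0F

    -- The core relabels C₀ as a graph of the form in 𝒦_{n,d-k}: the wing i_(rep i) of a
    -- collapsed i becomes the unstretched vertex i.
    fromCore toCore : V n → V n
    fromCore (i , t) = i , pick (rep i) t
    toCore   (i , t) = i , drop (rep i) t

    inCore : V n → Bool
    inCore (i , 0F)    = true
    inCore (i , suc _) = pending rep i

    core : State n
    core = record
      { stretched = pending rep
      ; adj       = λ u v → (inCore u ∧ inCore v) ∧ adj G (fromCore u) (fromCore v) }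

    present-core : ∀ u → present core u ≡ inCore u
    present-core (i , 0F)    = refl
    present-core (i , suc _) = refl

    inC₀⇒present : ∀ v → inC₀ rep v ≡ true → present G v ≡ true
    inC₀⇒present (i , t) v∈ with rep i in rep-i
    ... | 0F    = v∈
    ... | suc l rewrite ⌊≟⌋⇒≡ v∈ = collapsed⇒stretched i (λ rep≡0 → 0≢1+n (trans (sym rep≡0) rep-i))

    fromCore-inC₀ : ∀ u → inCore u ≡ true → inC₀ rep (fromCore u) ≡ true
    fromCore-inC₀ (i , 0F) _ with rep i
    ... | 0F    = refl
    ... | suc l = ⌊≟⌋-refl (suc l)
    fromCore-inC₀ (i , suc _) u∈ with rep i
    ... | 0F    = u∈
    ... | suc l = ⌊≟⌋-refl (suc l)

    toCore-inCore : ∀ v → inC₀ rep v ≡ true → inCore (toCore v) ≡ true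
    toCore-inCore (i , 0F) _ with rep i
    ... | 0F    = refl
    ... | suc _ = refl
    toCore-inCore (i , suc _) v∈ with rep i in rep-i
    ... | 0F    = trans (cong (λ r → isZero r ∧ stretched G i) rep-i) v∈
    ... | suc _ = refl

    fromCore-toCore : ∀ v → inC₀ rep v ≡ true → fromCore (toCore v) ≡ v
    fromCore-toCore (i , t) v∈ with rep i
    ... | 0F    = refl
    ... | suc _ = cong (i ,_) (sym (⌊≟⌋⇒≡ v∈))

    toCore-fromCore : ∀ u → inCore u ≡ true → toCore (fromCore u) ≡ u
    toCore-fromCore (i , 0F) _ with rep i
    ... | 0F    = refl
    ... | suc _ = refl
    toCore-fromCore (i , suc _) u∈ with rep i
    ... | 0F    = refl
    ... | suc _ = ⊥-elim (true≢false (sym u∈))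

    adj-core-toCore : ∀ v w → inC₀ rep v ≡ true → inC₀ rep w ≡ true →
                      adj core (toCore v) (toCore w) ≡ adj G v w
    adj-core-toCore v w v∈ w∈
      rewrite toCore-inCore v v∈ | toCore-inCore w w∈ | fromCore-toCore v v∈ | fromCore-toCore w w∈ = refl

    inCore-uncollapsed : ∀ {i t} → rep i ≡ 0F → inCore (i , t) ≡ present G (i , t)
    inCore-uncollapsed {i} {0F}    _     = refl
    inCore-uncollapsed {i} {suc _} rep≡0 = cong (λ r → isZero r ∧ stretched G i) rep≡0

    C₀-linked : ∀ b c → b ≢ c → ∃[ s ] ∃[ t ]
                (inC₀ rep (b , s) ≡ true × inC₀ rep (c , t) ≡ true × adj G (b , s) (c , t) ≡ true)
    C₀-linked b c b≢c with rep b ≟ 0F | rep c ≟ 0F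
    ... | no rep≢0 | _        = let t , t∈ , e = proj₂ (sound b rep≢0) c (b≢c ∘ sym) in
                                rep b , t , inC₀-rep rep _ , t∈ , e
    ... | yes _    | no rep≢0 = let s , s∈ , e = proj₂ (sound c rep≢0) b b≢c in
                                s , rep c , s∈ , inC₀-rep rep _ , trans (adj-sym _ _) e
    ... | yes b≡0  | yes c≡0  = let s , t , e = linked b c b≢c in
                                s , t , trans (inC₀-uncollapsed rep b≡0) (adj⇒presentˡ G-sc _ _ e)
                                      , trans (inC₀-uncollapsed rep c≡0) (adj⇒presentʳ G-sc _ _ e) , e

    core-isStretchedClique : IsStretchedClique core
    core-isStretchedClique = record
      { adj-sym     = λ u v → cong₂ _∧_ (∧-comm (inCore u) (inCore v)) (adj-sym _ _)
      ; adj-absent  = absent′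
      ; adj-within  = within′
      ; hub-private = hub-private′
      ; linked      = λ b c b≢c → let s , t , s∈ , t∈ , e = C₀-linked b c b≢c in
                        drop (rep b) s , drop (rep c) t , trans (adj-core-toCore (b , s) (c , t) s∈ t∈) e }
      where
      absent′ : ∀ u v → present core u ≡ false → adj core u v ≡ false
      absent′ u@(j , suc _) v j-absent =
        cong (λ p → (p ∧ inCore v) ∧ adj G (fromCore u) (fromCore v)) j-absent

      within′ : ∀ b x y → adj core (b , x) (b , y) ≡ (pending rep b ∧ innerAdj x y)
      within′ b x y with rep b in rep-b
      ... | 0F    = trans (∧-guard λ e → trans (inCore-uncollapsed {t = x} rep-b) (adj⇒presentˡ G-sc _ _ e)
                                       , trans (inCore-uncollapsed {t = y} rep-b) (adj⇒presentʳ G-sc _ _ e))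
                          (adj-within b x y)
      ... | suc _ = trans (cong ((inCore (b , x) ∧ inCore (b , y)) ∧_) (trans (adj-within b _ _) (∧-zeroʳ _)))
                          (∧-zeroʳ _)

      hub-private′ : ∀ b c t → pending rep b ≡ true → b ≢ c → adj core (b , 0F) (c , t) ≡ false
      hub-private′ b c t b-pending b≢c with rep b
      ... | 0F    = trans (cong (inCore (c , t) ∧_) (hub-private b c _ b-pending b≢c)) (∧-zeroʳ _)
      ... | suc _ = ⊥-elim (true≢false (sym b-pending))

    core-tilde : Tilde core
    core-tilde i ℓ i-pending ℓ≢0 = j , j≢i , non-adjacent
      where
      rep-i≡0 : rep i ≡ 0F
      rep-i≡0 = proj₁ (pending⇒uncollapsed rep i-pending)
      not-full : ¬ Full rep i ℓ
      not-full full = saturated i ℓ (proj₂ (pending⇒uncollapsed rep i-pending) , rep-i≡0 , ℓ≢0 , full)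
      witness : ∃[ j ] ¬ FullAt rep i ℓ j
      witness = ¬∀⟶∃¬ n (FullAt rep i ℓ) (fullAt? rep i ℓ) not-full
      j : Fin n
      j = proj₁ witness
      j≢i : j ≢ i
      j≢i j≡i = proj₂ witness (λ j≢i → ⊥-elim (j≢i j≡i))
      non-adjacent : ∀ v → Assoc core j v → adj core (i , ℓ) v ≡ false
      non-adjacent (_ , t) (refl , v∈) = ¬-not λ e → proj₂ witness λ _ →
        pick (rep j) t , fromCore-inC₀ (j , t) (trans (sym (present-core (j , t))) v∈) ,
        subst (λ r → adj G (i , pick r ℓ) (fromCore (j , t)) ≡ true) rep-i≡0 (∧-elimʳ _ e)

    isCollapsed : Fin n → Bool
    isCollapsed i = not (isZero (rep i))

    isCollapsed⇒rep≢0 : ∀ {i} → isCollapsed i ≡ true → rep i ≢ 0F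
    isCollapsed⇒rep≢0 i-collapsed rep≡0 rewrite rep≡0 = true≢false (sym i-collapsed)

    collapsedList : List (Fin n)
    collapsedList = select isCollapsed

    k : ℕ
    k = length collapsedList

    count-stretched : count (stretched G) ≡ count (pending rep) + k
    count-stretched = trans (count-∧-split (isZero ∘ rep) (stretched G))
      (cong (count (pending rep) +_) (trans (count-cong collapsed-∧) (sym (length-select isCollapsed))))
      where
      collapsed-∧ : ∀ i → not (isZero (rep i)) ∧ stretched G i ≡ isCollapsed i
      collapsed-∧ i with rep i ≟ 0F
      ... | yes rep≡0 rewrite rep≡0 = refl
      ... | no rep≢0 rewrite isZero-≢0 rep≢0 = collapsed⇒stretched i rep≢0

    collapsedAt : ∀ r → rep (lookup collapsedList r) ≢ 0F
    collapsedAt r = isCollapsed⇒rep≢0 (∈-select⁻ isCollapsed (∈-lookup r))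

    hubOf wingOf : Fin k → V n
    hubOf  r = lookup collapsedList r , 0F
    wingOf r = lookup collapsedList r , otherWing (rep (lookup collapsedList r))

    collapsedList-injective : ∀ r r′ → lookup collapsedList r ≡ lookup collapsedList r′ → r ≡ r′
    collapsedList-injective = lookup-injective (select-unique isCollapsed)

    hub-adj-wing : ∀ r → adj G (hubOf r) (wingOf r) ≡ true
    hub-adj-wing r
      rewrite adj-within (lookup collapsedList r) 0F (otherWing (rep (lookup collapsedList r)))
            | collapsed⇒stretched _ (collapsedAt r) = innerAdj-otherWing _

    OutsideEdges : V n → Set
    OutsideEdges v = present G v ≡ true × (∀ r → hubOf r ≢ v × wingOf r ≢ v)

    hub∉C₀ : ∀ r {v} → hubOf r ≡ v → inC₀ rep v ≢ true
    hub∉C₀ r refl hub∈ = collapsedAt r (sym (inC₀-collapsed rep (collapsedAt r) hub∈))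

    wing∉C₀ : ∀ r {v} → wingOf r ≡ v → inC₀ rep v ≢ true
    wing∉C₀ r refl wing∈ = otherWing≢self (collapsedAt r) (inC₀-collapsed rep (collapsedAt r) wing∈)

    inC₀⇒outsideEdges : ∀ v → inC₀ rep v ≡ true → OutsideEdges v
    inC₀⇒outsideEdges v v∈ = inC₀⇒present v v∈ , λ r → (λ e → hub∉C₀ r e v∈) , (λ e → wing∉C₀ r e v∈)

    outsideEdges⇒inC₀ : ∀ v → OutsideEdges v → inC₀ rep v ≡ true
    outsideEdges⇒inC₀ (i , t) (v-present , avoids) with rep i ≟ 0F
    ... | yes rep≡0 = trans (inC₀-uncollapsed rep rep≡0) v-present
    ... | no rep≢0  = subst (λ t → inC₀ rep (i , t) ≡ true) (sym t≡rep) (inC₀-rep rep _)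
      where
      i∈ : i ∈ collapsedList
      i∈ = ∈-select⁺ isCollapsed (cong not (isZero-≢0 rep≢0))
      r : Fin k
      r = Any.index i∈
      i≡ : i ≡ lookup collapsedList r
      i≡ = lookup-index i∈
      t≢0 : t ≢ 0F
      t≢0 t≡0 = proj₁ (avoids r) (cong₂ _,_ (sym i≡) (sym t≡0))
      t≢other : t ≢ otherWing (rep i)
      t≢other t≡o = proj₂ (avoids r) (cong₂ _,_ (sym i≡) (trans (cong (otherWing ∘ rep) (sym i≡)) (sym t≡o)))
      t≡rep : t ≡ rep i
      t≡rep = remaining-wing rep≢0 t≢0 t≢other

    decomposition : ∀ {d} → count (stretched G) ≡ d → Decomp G d k
    decomposition {d} count≡d = record
      { hub        = hubOf
      ; wing       = wingOf
      ; hubIsHub   = λ r → collapsed⇒stretched _ (collapsedAt r) , refl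
      ; wingIsWing = λ r → collapsed⇒stretched _ (collapsedAt r) , otherWing≢0
      ; isEdge     = hub-adj-wing
      ; hubInj     = λ r r′ e → collapsedList-injective r r′ (cong proj₁ e)
      ; wingInj    = λ r r′ e → collapsedList-injective r r′ (cong proj₁ e)
      ; hubWing    = λ r r′ e → otherWing≢0 (sym (cong proj₂ e))
      ; T          = T
      ; T-reach    = subst (λ m → Reach m T) core-size T-reach
      ; T-tilde    = Tilde-≋ T≋core core-tilde
      ; f          = toCore
      ; g          = fromCore
      ; f-pres     = λ v v-out → trans (present-≋ T≋core (toCore v))
                       (trans (present-core (toCore v)) (toCore-inCore v (outsideEdges⇒inC₀ v v-out)))
      ; g-pres     = λ u u∈ → inC₀⇒outsideEdges _ (fromCore-inC₀ u (inCore⇐T u u∈))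
      ; gf         = λ v v-out → fromCore-toCore v (outsideEdges⇒inC₀ v v-out)
      ; fg         = λ u u∈ → toCore-fromCore u (inCore⇐T u u∈)
      ; adj-pres   = λ v w v-out w-out → sym (trans (_≋_.adj-≗ T≋core _ _)
                       (adj-core-toCore v w (outsideEdges⇒inC₀ v v-out) (outsideEdges⇒inC₀ w w-out))) }
      where
      realised : ∃[ T ] (Reach (count (pending rep)) T × T ≋ core)
      realised = isStretchedClique⇒reach (count (pending rep)) core-isStretchedClique refl
      T : State n
      T = proj₁ realised
      T-reach : Reach (count (pending rep)) T
      T-reach = proj₁ (proj₂ realised)
      T≋core : T ≋ core
      T≋core = proj₂ (proj₂ realised)
      inCore⇐T : ∀ u → present T u ≡ true → inCore u ≡ true
      inCore⇐T u u∈ = trans (sym (present-core u)) (trans (sym (present-≋ T≋core u)) u∈)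
      core-size : count (pending rep) ≡ d ∸ k
      core-size = sym (trans (cong (_∸ k) (trans (sym count≡d) count-stretched)) (Nat.m+n∸n≡m _ k))

    -- The vertices i_(rep i) of collapsed and unstretched i are the only vertices of C₀
    -- associated with i, so the links of C₀ make them pairwise adjacent.
    isSingle : Fin n → Bool
    isSingle i = isCollapsed i ∨ not (stretched G i)

    single-inC₀ : ∀ {i t} → isSingle i ≡ true → inC₀ rep (i , t) ≡ true → t ≡ rep i
    single-inC₀ {i} {t} i-single t∈ with rep i ≟ 0F
    ... | no rep≢0 = inC₀-collapsed rep rep≢0 t∈
    ... | yes rep≡0 rewrite rep≡0 with t
    ...   | 0F    = refl
    ...   | suc _ = ⊥-elim (true≢false (sym (subst (λ b → not b ≡ true) t∈ i-single)))

    clique : List (V n)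
    clique = map (λ i → i , rep i) (select isSingle)

    clique-isClique : IsClique G clique
    clique-isClique = Unique.map⁺ (cong proj₁) (select-unique isSingle) , All.tabulate present′ , adjacent
      where
      present′ : ∀ {v} → v ∈ clique → present G v ≡ true
      present′ v∈ with ∈-map⁻ _ v∈
      ... | i , _ , refl = inC₀⇒present _ (inC₀-rep rep i)
      adjacent : ∀ v w → v ∈ clique → w ∈ clique → v ≢ w → adj G v w ≡ true
      adjacent v w v∈ w∈ v≢w with ∈-map⁻ _ v∈ | ∈-map⁻ _ w∈
      ... | i , i∈ , refl | j , j∈ , refl =
        let s , t , s∈ , t∈ , e = C₀-linked i j (λ i≡j → v≢w (cong (λ x → x , rep x) i≡j)) in
        subst₂ (λ s t → adj G (i , s) (j , t) ≡ true)
               (single-inC₀ (∈-select⁻ isSingle i∈) s∈) (single-inC₀ (∈-select⁻ isSingle j∈) t∈) e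

    length-clique : length clique ≡ count (not ∘ stretched G) + k
    length-clique = begin
      length clique                  ≡⟨ length-map _ (select isSingle) ⟩
      length (select isSingle)       ≡⟨ length-select isSingle ⟩
      count isSingle                 ≡⟨ count-∧-split (isZero ∘ rep) isSingle ⟩
      count (λ i → isZero (rep i) ∧ isSingle i) + count (λ i → isCollapsed i ∧ isSingle i)
                                     ≡⟨ cong₂ _+_ (count-cong uncollapsed-single) collapsed-single ⟩
      count (not ∘ stretched G) + k  ∎
      where
      open ≡-Reasoning
      uncollapsed-single : ∀ i → isZero (rep i) ∧ isSingle i ≡ not (stretched G i)
      uncollapsed-single i with rep i ≟ 0F
      ... | yes rep≡0 rewrite rep≡0 = refl
      ... | no rep≢0 rewrite isZero-≢0 rep≢0 | collapsed⇒stretched i rep≢0 = refl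
      collapsed-single : count (λ i → isCollapsed i ∧ isSingle i) ≡ k
      collapsed-single =
        trans (count-cong (λ i → ∧-abs-∨ (isCollapsed i) _)) (sym (length-select isCollapsed))

deficiency-bound : ∀ {k u d n ω} → u + k ≤ ω → d + u ≡ n → k ≤ ω + d ∸ n
deficiency-bound {k} {u} {d} {n} {ω} u+k≤ω refl =
  subst (k ≤_) ω∸u≡ (Nat.m+n≤o⇒m≤o∸n k (subst (_≤ ω) (Nat.+-comm u k) u+k≤ω))
  where
  ω∸u≡ : ω ∸ u ≡ ω + d ∸ (d + u)
  ω∸u≡ = trans (sym (Nat.[m+n]∸[m+o]≡n∸o d ω u)) (cong (_∸ (d + u)) (Nat.+-comm d ω))

lemma2p9 : (n d : ℕ) → 3 ≤ n → (G : State n) → Reach d G →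
    (ω : ℕ) → CliqueNumber G ω →
    ∃[ k ] (k ≤ (ω + d) ∸ n × Decomp G d k)
-- The bound holds for every n.
lemma2p9 n d _ G G-reach ω (_ , ω-maximal) =
  k , deficiency-bound (subst (_≤ ω) length-clique (ω-maximal clique clique-isClique)) d+u≡n ,
  decomposition count≡d
  where
  open Decomposition (reach⇒isStretchedClique G-reach)
  open Core (proj₁ (proj₂ sound-saturated)) (proj₂ (proj₂ sound-saturated))
  count≡d : count (stretched G) ≡ d
  count≡d = reach⇒count G-reach
  d+u≡n : d + count (not ∘ stretched G) ≡ n
  d+u≡n = trans (cong (_+ count (not ∘ stretched G)) (sym count≡d)) (count-complement (stretched G))
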